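{- Let $H$ be a graph with $\mathrm{diam}(H)=2$ and let $T$ be a tree. If $T$ is different from $K_2$, then $T\,\Box\,H$ does not contain an EOD-set that is parallel with respect to $T$.
   Context: All graphs are finite and simple. An EOD-set of a graph $X$ is a set $D\subseteq V(X)$ with $\bigcup_{v\in D}N(v)=V(X)$ and $N(u)\cap N(v)=\emptyset$ for all distinct $u,v\in D$ ($N$ = open neighborhood). In the Cartesian product $T\,\Box\,H$, vertices $(t,h),(t',h')$ are adjacent iff ($tt'\in E(T)$ and $h=h'$) or ($t=t'$ and $hh'\in E(H)$). An EOD-set $D$ of $T\,\Box\,H$ is parallel with respect to $T$ if for every edge of the subgraph induced by $D$, its two end vertices have distinct $T$-coordinates (i.e. its projection onto $T$ is an edge, not a single vertex). -}

module Defs where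

open import Data.Nat using (ℕ; suc; _≤_)
open import Data.Fin using (Fin)
open import Data.Product using (Σ; ∃; _×_; _,_; proj₁; proj₂)
open import Data.Sum using (_⊎_)
open import Data.List using (List; []; _∷_; length)
open import Data.List.Relation.Unary.Unique.Propositional using (Unique)
open import Relation.Nullary using (¬_)
open import Relation.Binary.PropositionalEquality using (_≡_; _≢_)
open import Function.Bundles using (_↔_; Inverse)
open import Data.Unit using (⊤)

record Graph : Set₁ where
  field
    size     : ℕ
    Adj      : Fin size → Fin size → Set
    sym      : ∀ {u v} → Adj u v → Adj v u
    irrefl   : ∀ {u} → ¬ Adj u u
    nonEmpty : 1 ≤ size

open Graph public

Vertex : Graph → Set
Vertex G = Fin (size G)

data Walk (G : Graph) : Vertex G → Vertex G → Set where
  here : ∀ {u} → Walk G u u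
  step : ∀ {u w v} → Adj G u w → Walk G w v → Walk G u v

walkLength : ∀ {G u v} → Walk G u v → ℕ
walkLength here = 0
walkLength (step _ p) = suc (walkLength p)

Connected : Graph → Set
Connected G = ∀ u v → Walk G u v

DistLe : (G : Graph) → Vertex G → Vertex G → ℕ → Set
DistLe G u v k = Σ (Walk G u v) λ p → walkLength p ≤ k

-- diam(G) = 2: every pair is at distance ≤ 2 and some pair is at distance exactly 2
-- (distinct and non-adjacent).
Diam2 : Graph → Set
Diam2 G = (∀ u v → DistLe G u v 2)
        × ∃ λ u → ∃ λ v → u ≢ v × ¬ Adj G u v

ConsecAdj : (G : Graph) → List (Vertex G) → Set
ConsecAdj G [] = ⊤
ConsecAdj G (x ∷ []) = ⊤
ConsecAdj G (x ∷ y ∷ xs) = Adj G x y × ConsecAdj G (y ∷ xs)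

-- a cycle: distinct vertices v₀ … v_k (k ≥ 2, i.e. at least 3 vertices),
-- consecutive ones adjacent and v_k adjacent to v₀
HasCycle : Graph → Set
HasCycle G = ∃ λ (v₀ : Vertex G) → ∃ λ (rest : List (Vertex G)) → ∃ λ (vₖ : Vertex G) →
  Unique (v₀ ∷ rest Data.List.++ (vₖ ∷ [])) × 1 ≤ length rest
  × ConsecAdj G (v₀ ∷ rest Data.List.++ (vₖ ∷ [])) × Adj G vₖ v₀

IsTree : Graph → Set
IsTree G = Connected G × ¬ HasCycle G

K₂ : Graph
K₂ = record { size = 2 ; Adj = _≢_ ; sym = λ p q → p (Relation.Binary.PropositionalEquality.sym q)
            ; irrefl = λ p → p Relation.Binary.PropositionalEquality.refl
            ; nonEmpty = Data.Nat.s≤s Data.Nat.z≤n }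

Isomorphic : Graph → Graph → Set
Isomorphic G H = Σ (Vertex G ↔ Vertex H) λ f →
  ∀ u v → (Adj G u v → Adj H (Inverse.to f u) (Inverse.to f v))
        × (Adj H (Inverse.to f u) (Inverse.to f v) → Adj G u v)

PVertex : Graph → Graph → Set
PVertex T H = Vertex T × Vertex H

PAdj : (T H : Graph) → PVertex T H → PVertex T H → Set
PAdj T H (t , h) (t' , h') = (Adj T t t' × h ≡ h') ⊎ (t ≡ t' × Adj H h h')

IsEOD : (T H : Graph) → (PVertex T H → Set) → Set
IsEOD T H D =
  (∀ x → ∃ λ v → D v × PAdj T H v x)
  × (∀ u v → D u → D v → u ≢ v → ¬ (∃ λ x → PAdj T H u x × PAdj T H v x))

IsParallel : (T H : Graph) → (PVertex T H → Set) → Set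
IsParallel T H D = ∀ u v → D u → D v → PAdj T H u v → proj₁ u ≢ proj₁ v

module Submission where

open import Defs
open import Relation.Nullary using (¬_)
open import Data.Product using (_×_; ∃)

open import Data.Nat using (ℕ; zero; suc; _+_; _<_; _≤_; z≤n; s≤s)
open import Data.Nat.Properties using (+-identityʳ; +-suc; m≤n+m; m≤n⇒m≤1+n; ≤-refl)
open import Data.Fin as Fin using (Fin; zero; suc; _≟_)
open import Data.Fin.Properties using (pigeonhole)
open import Data.Product using (Σ; _,_; proj₁; proj₂)
open import Data.Sum using (inj₁; inj₂; _⊎_)
open import Data.List using (List; []; _∷_; _++_; [_]; length; lookup)
open import Data.List.Properties using (++-assoc)
open import Data.List.Relation.Unary.All as All using (All; []; _∷_)
open import Data.List.Relation.Unary.All.Properties using (++⁻ˡ)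
open import Data.List.Relation.Unary.All.Properties.Core using (¬Any⇒All¬)
open import Data.List.Relation.Unary.AllPairs using ([]; _∷_)
open import Data.List.Relation.Unary.Unique.Propositional using (Unique)
open import Data.List.Membership.Propositional using (_∈_)
open import Data.List.Membership.Propositional.Properties using (∈-∃++; ∈-lookup)
open import Data.Empty using (⊥; ⊥-elim)
open import Data.Unit using (⊤; tt)
open import Relation.Nullary using (yes; no)
open import Relation.Binary.PropositionalEquality as ≡ using (_≡_; _≢_; refl; cong; subst)
open import Function.Construct.Identity using (↔-id)

-- Let D be a parallel EOD-set of T □ H with diam(H) = 2.
-- (1) Each fibre {t} × H contains at most one vertex of D (two of them would be
--     adjacent or share a neighbour, as diam(H) ≤ 2), and every (t,h) ∈ D is
--     dominated by some (t',h) ∈ D with t' adjacent to t (parallelism).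
-- (2) If t is a leaf of T with neighbour p, then (t,h₀),(p,h₀) ∈ D for a vertex
--     h₀ adjacent to all other vertices of H (a universal vertex).
-- (3) Take a longest path v₀ v₁ v₂ … of T with at least three vertices.  Its end
--     v₀ is a leaf, so by (2) the fibre of v₂ contains no vertex of D; hence some
--     neighbour s of v₂ with s ≠ v₃ carries a D-vertex (s,x) with x non-universal.
--     The D-partner s' of s gives another longest path s' s v₂ …, and (2) at the
--     leaf s' forces x to be universal: contradiction.
-- Hence T has no path on three vertices, so T has one or two vertices; one vertex
-- contradicts (1), two vertices means T ≅ K₂.

-- If P fails above N, and P (suc L) failing makes P L fail, then P fails everywhere.
-- This replaces "choose a longest path" by a constructive downward induction.
downwardInduction : (P : ℕ → Set) (N : ℕ) → (∀ L → N < L → ¬ P L) →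
                    (∀ L → ¬ P (suc L) → ¬ P L) → ∀ L → ¬ P L
downwardInduction P N above descend L = fromDistance (suc N) L (m≤n+m (suc N) L)
  where
  fromDistance : ∀ d L → N < L + d → ¬ P L
  fromDistance zero    L lt = above L (subst (N <_) (+-identityʳ L) lt)
  fromDistance (suc d) L lt = descend L (fromDistance d (suc L) (subst (N <_) (+-suc L d) lt))

firstEdge : (G : Graph) → ∀ {a b} → a ≢ b → Walk G a b → ∃ λ w → Adj G a w
firstEdge G a≢b here = ⊥-elim (a≢b refl)
firstEdge G a≢b (step {w = w} e _) = w , e

connectedPairIsK₂ : (G : Graph) → size G ≡ 2 → Connected G → Isomorphic G K₂
connectedPairIsK₂ G@(record { size = .2 }) refl conn
  with firstEdge G (λ ()) (conn zero (suc zero))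
... | zero , e = ⊥-elim (irrefl G e)
... | suc zero , e = ↔-id (Fin 2) , λ a b → adjDistinct a b , distinctAdj a b
  where
  adjDistinct : ∀ a b → Adj G a b → a ≢ b
  adjDistinct a .a ab refl = irrefl G ab
  distinctAdj : ∀ a b → a ≢ b → Adj G a b
  distinctAdj zero zero a≢b = ⊥-elim (a≢b refl)
  distinctAdj zero (suc zero) _ = e
  distinctAdj (suc zero) zero _ = sym G e
  distinctAdj (suc zero) (suc zero) a≢b = ⊥-elim (a≢b refl)

-- Paths are lists of distinct vertices with consecutive ones adjacent; the
-- index of Path counts vertices.
module Paths (G : Graph) where

  open import Data.List.Membership.DecPropositional {A = Vertex G} _≟_ using (_∈?_)

  IsPath : List (Vertex G) → Set
  IsPath xs = Unique xs × ConsecAdj G xs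

  Path : ℕ → Set
  Path L = Σ (List (Vertex G)) λ xs → IsPath xs × length xs ≡ L

  pathTail : ∀ {x xs} → IsPath (x ∷ xs) → IsPath xs
  pathTail {xs = []}    _                  = [] , tt
  pathTail {xs = _ ∷ _} ((_ ∷ U) , (_ , C)) = U , C

  unique-prefix : ∀ xs {ys : List (Vertex G)} → Unique (xs ++ ys) → Unique xs
  unique-prefix []       _        = []
  unique-prefix (x ∷ xs) (p ∷ ps) = ++⁻ˡ xs p ∷ unique-prefix xs ps

  consecAdj-prefix : ∀ xs {ys} → ConsecAdj G (xs ++ ys) → ConsecAdj G xs
  consecAdj-prefix []           _       = tt
  consecAdj-prefix (x ∷ [])     _       = tt
  consecAdj-prefix (x ∷ y ∷ xs) (a , c) = a , consecAdj-prefix (y ∷ xs) c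

  closeCycle : ∀ a b rest w → IsPath (a ∷ b ∷ rest) → w ∈ rest →
               Adj G w a → HasCycle G
  closeCycle a b rest w (U , C) w∈rest wa with ∈-∃++ w∈rest
  ... | A , B , refl =
    a , b ∷ A , w , unique-prefix cycle (subst Unique split U) , s≤s z≤n
      , consecAdj-prefix cycle (subst (ConsecAdj G) split C) , wa
    where
    cycle = a ∷ b ∷ A ++ [ w ]
    split : a ∷ b ∷ A ++ w ∷ B ≡ cycle ++ B
    split = ≡.sym (++-assoc (a ∷ b ∷ A) [ w ] B)

  NotHead : Vertex G → List (Vertex G) → Set
  NotHead w []      = ⊤
  NotHead w (r ∷ _) = w ≢ r

  prepend : ¬ HasCycle G → ∀ {a rest w} → IsPath (a ∷ rest) → Adj G w a → NotHead w rest →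
            IsPath (w ∷ a ∷ rest)
  prepend acyc {a} {rest} {w} P@(U , C) wa notHead = (avoidsPath rest P notHead ∷ U) , (wa , C)
    where
    w≢a : w ≢ a
    w≢a refl = irrefl G wa
    avoidsPath : ∀ rest → IsPath (a ∷ rest) → NotHead w rest → All (w ≢_) (a ∷ rest)
    avoidsPath [] _ _ = w≢a ∷ []
    avoidsPath (b ∷ rest) P w≢b
      with w ∈? rest
    ... | yes w∈rest = ⊥-elim (acyc (closeCycle a b rest w P w∈rest wa))
    ... | no  w∉rest = w≢a ∷ w≢b ∷ ¬Any⇒All¬ rest w∉rest

  pathLengthBound : ∀ L → size G < L → ¬ Path L
  pathLengthBound L lt (xs , (U , _) , refl) with pigeonhole lt (lookup xs)
  ... | i , j , i<j , same = distinctEntries U i j i<j same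
    where
    distinctEntries : ∀ {xs : List (Vertex G)} → Unique xs →
                      (i j : Fin (length xs)) → i Fin.< j → lookup xs i ≢ lookup xs j
    distinctEntries (p ∷ _)  zero    (suc j) _         = All.lookup p (∈-lookup j)
    distinctEntries (_ ∷ ps) (suc i) (suc j) (s≤s i<j) = distinctEntries ps i j i<j

  pathThrough : ∀ {a b c} → Adj G a b → c ≢ a → c ≢ b → Walk G a c → Path 3
  pathThrough ab c≢a c≢b here = ⊥-elim (c≢a refl)
  pathThrough {a} {b} ab c≢a c≢b (step {w = w} aw walk) with w ≟ b
  ... | yes refl = pathThrough (sym G ab) c≢b c≢a walk
  ... | no  w≢b  = w ∷ a ∷ b ∷ [] , (distinct , (sym G aw , ab , tt)) , refl
    where
    w≢a : w ≢ a
    w≢a refl = irrefl G aw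
    a≢b : a ≢ b
    a≢b refl = irrefl G ab
    distinct : Unique (w ∷ a ∷ b ∷ [])
    distinct = (w≢a ∷ w≢b ∷ []) ∷ (a≢b ∷ []) ∷ [] ∷ []

  threeVertexPath : Connected G → (x y z : Vertex G) → x ≢ y → x ≢ z → y ≢ z → Path 3
  threeVertexPath conn x y z x≢y x≢z y≢z with firstEdge G x≢y (conn x y)
  ... | w , xw with w ≟ y
  ... | yes refl = pathThrough xw (λ z≡x → x≢z (≡.sym z≡x)) (λ z≡y → y≢z (≡.sym z≡y)) (conn x z)
  ... | no  w≢y  = pathThrough xw (λ y≡x → x≢y (≡.sym y≡x)) (λ y≡w → w≢y (≡.sym y≡w)) (conn x y)

Universal : (H : Graph) → Vertex H → Set
Universal H h = ∀ x → x ≢ h → Adj H h x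

module ParallelEOD (T H : Graph) (D : PVertex T H → Set) (eod : IsEOD T H D)
                   (parallel : IsParallel T H D) (diam2 : Diam2 H) where

  dominates : ∀ x → ∃ λ v → D v × PAdj T H v x
  dominates = proj₁ eod

  noCommonNeighbour : ∀ v w → D v → D w → v ≢ w → ¬ (∃ λ x → PAdj T H v x × PAdj T H w x)
  noCommonNeighbour = proj₂ eod

  u v : Vertex H
  u = proj₁ (proj₂ diam2)
  v = proj₁ (proj₂ (proj₂ diam2))

  u≢v : u ≢ v
  u≢v = proj₁ (proj₂ (proj₂ (proj₂ diam2)))

  u≁v : ¬ Adj H u v
  u≁v = proj₂ (proj₂ (proj₂ (proj₂ diam2)))

  u-nonUniversal : ¬ Universal H u
  u-nonUniversal uni = u≁v (uni v (λ v≡u → u≢v (≡.sym v≡u)))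

  v-nonUniversal : ¬ Universal H v
  v-nonUniversal uni = u≁v (sym H (uni u u≢v))

  -- (1a) A fibre {t} × H meets D at most once: two such vertices would be
  -- adjacent (forbidden by parallelism) or share a neighbour (forbidden by EOD).
  fibreAtMostOnce : ∀ {t a b} → D (t , a) → D (t , b) → a ≡ b
  fibreAtMostOnce {t} {a} {b} Da Db with a ≟ b
  ... | yes a≡b = a≡b
  ... | no  a≢b with proj₁ diam2 a b
  ... | here , _ = ⊥-elim (a≢b refl)
  ... | step ab here , _ = ⊥-elim (parallel (t , a) (t , b) Da Db (inj₂ (refl , ab)) refl)
  ... | step {w = w} aw (step wb here) , _ =
    ⊥-elim (noCommonNeighbour (t , a) (t , b) Da Db (λ eq → a≢b (cong proj₂ eq))
      ((t , w) , inj₂ (refl , aw) , inj₂ (refl , sym H wb)))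
  ... | step _ (step _ (step _ _)) , s≤s (s≤s ())

  -- (1b) A vertex (t,h) of D is dominated by its D-partner (t',h), t' ~ t:
  -- a dominator in the same fibre would be a D-neighbour with equal T-coordinate.
  partner : ∀ {t h} → D (t , h) → ∃ λ t' → Adj T t' t × D (t' , h)
  partner {t} {h} Dth with dominates (t , h)
  ... | (t' , _) , Dt' , inj₁ (t't , refl) = t' , t't , Dt'
  ... | (t' , h') , Dt' , inj₂ (t'≡t , h'h) =
    ⊥-elim (parallel (t' , h') (t , h) Dt' Dth (inj₂ (t'≡t , h'h)) t'≡t)

  tHasEdge : Vertex T → ∃ λ t → ∃ λ t' → Adj T t' t
  tHasEdge t with dominates (t , u)
  ... | (t₀ , _) , Dt₀ , _ with partner Dt₀
  ... | t' , t't₀ , _ = t₀ , t' , t't₀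

  IsLeafWithNeighbour : Vertex T → Vertex T → Set
  IsLeafWithNeighbour t p = ∀ w → Adj T w t → w ≡ p

  leafPair : ∀ {t p} → IsLeafWithNeighbour t p →
             ∃ λ h₀ → D (t , h₀) × D (p , h₀) × Universal H h₀
  leafPair {t} {p} leaf = h₀ , Dt , Dp , universal
    where
    leafDomination : ∀ x → D (p , x) ⊎ (∃ λ b → D (t , b) × Adj H b x)
    leafDomination x with dominates (t , x)
    ... | (t' , b) , Dt'b , inj₁ (t't , refl) = inj₁ (subst (λ s → D (s , b)) (leaf t' t't) Dt'b)
    ... | (_  , b) , Dtb  , inj₂ (refl , bx) = inj₂ (b , Dtb , bx)
    -- The fibre of t meets D, since (p,u) and (p,v) cannot both lie in D.
    fibreOfLeaf : ∃ λ h → D (t , h)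
    fibreOfLeaf with leafDomination u | leafDomination v
    ... | inj₂ (b , Db , _) | _                 = b , Db
    ... | inj₁ _            | inj₂ (b , Db , _) = b , Db
    ... | inj₁ Du           | inj₁ Dv           = ⊥-elim (u≢v (fibreAtMostOnce Du Dv))
    h₀ : Vertex H
    h₀ = proj₁ fibreOfLeaf
    Dt : D (t , h₀)
    Dt = proj₂ fibreOfLeaf
    Dp : D (p , h₀)
    Dp with partner Dt
    ... | t' , t't , Dt' = subst (λ s → D (s , h₀)) (leaf t' t't) Dt'
    universal : Universal H h₀
    universal x x≢h₀ with leafDomination x
    ... | inj₁ Dpx           = ⊥-elim (x≢h₀ (fibreAtMostOnce Dpx Dp))
    ... | inj₂ (b , Db , bx) = subst (λ c → Adj H c x) (fibreAtMostOnce Db Dt) bx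

  -- Beside an adjacent pair (t,h₀),(p,h₀) ∈ D with h₀ universal, the fibre of any
  -- other neighbour q of p avoids D: (q,h₀) would share the neighbour (p,h₀) with
  -- (t,h₀), and (q,y), y ≠ h₀, would share the neighbour (p,y) with (p,h₀).
  emptyFibreBeyond : ∀ {t p q h₀} → Adj T t p → Adj T p q → t ≢ q →
                     D (t , h₀) → D (p , h₀) → Universal H h₀ → ∀ y → ¬ D (q , y)
  emptyFibreBeyond {t} {p} {q} {h₀} tp pq t≢q Dt Dp universal y Dq with y ≟ h₀
  ... | yes refl = noCommonNeighbour (q , h₀) (t , h₀) Dq Dt (λ eq → t≢q (≡.sym (cong proj₁ eq)))
                     ((p , h₀) , inj₁ (sym T pq , refl) , inj₁ (tp , refl))
  ... | no  y≢h₀ = noCommonNeighbour (q , y) (p , h₀) Dq Dp (λ eq → irrefl T (subst (Adj T p) (cong proj₁ eq) pq))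
                     ((p , y) , inj₁ (sym T pq , refl) , inj₂ (refl , universal y y≢h₀))

  dominatedAcross : ∀ {q} → (∀ y → ¬ D (q , y)) → ∀ x → ∃ λ s → Adj T s q × D (s , x)
  dominatedAcross empty x with dominates (_ , x)
  ... | (s , _) , Ds , inj₁ (sq , refl) = s , sq , Ds
  ... | (_ , y) , Dy , inj₂ (refl , _)  = ⊥-elim (empty y Dy)

  open Paths T

  -- A D-free fibre has a dominator (s,x) with x non-universal and s different
  -- from a prescribed vertex, since (r,u) and (r,v) cannot both lie in D.
  nonUniversalDominator : ∀ {q} → (∀ y → ¬ D (q , y)) → ∀ R →
      ∃ λ s → ∃ λ x → ¬ Universal H x × Adj T s q × D (s , x) × NotHead s R
  nonUniversalDominator empty R with dominatedAcross empty u | dominatedAcross empty v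
  nonUniversalDominator empty []      | s , sq , Dsu | _ = s , u , u-nonUniversal , sq , Dsu , tt
  nonUniversalDominator empty (r ∷ _) | s , sq , Dsu | s' , s'q , Ds'v with s ≟ r
  ... | no  s≢r  = s , u , u-nonUniversal , sq , Dsu , s≢r
  ... | yes refl = s' , v , v-nonUniversal , s'q , Ds'v ,
                   λ s'≡s → u≢v (fibreAtMostOnce Dsu (subst (λ z → D (z , v)) s'≡s Ds'v))

  module LongestPath (acyclic : ¬ HasCycle T) (L : ℕ) (maximal : ¬ Path (suc L)) where

    -- The first vertex of a path on L vertices is a leaf: any other neighbour
    -- would extend the path.
    endpointIsLeaf : ∀ {p₀ p₁ R} → IsPath (p₀ ∷ p₁ ∷ R) → length (p₀ ∷ p₁ ∷ R) ≡ L →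
                     IsLeafWithNeighbour p₀ p₁
    endpointIsLeaf {p₀} {p₁} {R} P len w wp₀ with w ≟ p₁
    ... | yes w≡p₁ = w≡p₁
    ... | no  w≢p₁ = ⊥-elim (maximal (w ∷ p₀ ∷ p₁ ∷ R , prepend acyclic P wp₀ w≢p₁ , cong suc len))

    -- In a path p₀ p₁ … on L vertices, the D-vertex of the fibre of p₁ lies in a
    -- universal layer, by the leaf pair at p₀.
    secondLayerUniversal : ∀ {p₀ p₁ R x} → IsPath (p₀ ∷ p₁ ∷ R) → length (p₀ ∷ p₁ ∷ R) ≡ L →
                           D (p₁ , x) → Universal H x
    secondLayerUniversal P len Dx with leafPair (endpointIsLeaf P len)
    ... | _ , _ , Dh , universal = subst (Universal H) (fibreAtMostOnce Dh Dx) universal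

    -- In a path v₀ v₁ v₂ … on L vertices, the fibre of v₂ avoids D, by the leaf
    -- pair at v₀.
    thirdFibreEmpty : ∀ {v₀ v₁ v₂ R} → IsPath (v₀ ∷ v₁ ∷ v₂ ∷ R) → length (v₀ ∷ v₁ ∷ v₂ ∷ R) ≡ L →
                      ∀ y → ¬ D (v₂ , y)
    thirdFibreEmpty P@(((_ ∷ v₀≢v₂ ∷ _) ∷ _) , (v₀v₁ , v₁v₂ , _)) len
      with leafPair (endpointIsLeaf P len)
    ... | _ , Dv₀ , Dv₁ , universal = emptyFibreBeyond v₀v₁ v₁v₂ v₀≢v₂ Dv₀ Dv₁ universal

    -- (3) No path on L ≥ 3 vertices exists: a non-universal dominator (s,x) of the
    -- empty fibre of v₂ and the partner s' of s give the path s' s v₂ R on L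
    -- vertices, in which x must be universal.
    noMaximalPath : ∀ {v₀ v₁ v₂ R} → IsPath (v₀ ∷ v₁ ∷ v₂ ∷ R) → length (v₀ ∷ v₁ ∷ v₂ ∷ R) ≡ L → ⊥
    noMaximalPath {v₂ = v₂} {R = R} P len with nonUniversalDominator (thirdFibreEmpty P len) R
    ... | s , x , x-nonUniversal , sv₂ , Dsx , s≢next with partner Dsx
    ... | s' , s's , Ds'x = x-nonUniversal (secondLayerUniversal newPath len Dsx)
      where
      s'≢v₂ : s' ≢ v₂
      s'≢v₂ refl = thirdFibreEmpty P len x Ds'x
      newPath : IsPath (s' ∷ s ∷ v₂ ∷ R)
      newPath = prepend acyclic (prepend acyclic (pathTail (pathTail P)) sv₂ s≢next) s's s'≢v₂

  noLongPath : ¬ HasCycle T → ∀ L → Path L → ¬ (3 ≤ L)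
  noLongPath acyclic L path 3≤L =
    downwardInduction LongPath (size T) beyondBound shorten L (path , 3≤L)
    where
    LongPath : ℕ → Set
    LongPath L = Path L × 3 ≤ L
    beyondBound : ∀ L → size T < L → ¬ LongPath L
    beyondBound L lt (path , _) = pathLengthBound L lt path
    shorten : ∀ L → ¬ LongPath (suc L) → ¬ LongPath L
    shorten L none ((_ ∷ _ ∷ _ ∷ _ , P , len) , 3≤L) =
      LongestPath.noMaximalPath acyclic L (λ longer → none (longer , m≤n⇒m≤1+n 3≤L)) P len
    shorten L none ((_ ∷ _ ∷ [] , _ , refl) , s≤s (s≤s ()))
    shorten L none ((_ ∷ [] , _ , refl) , s≤s ())
    shorten L none (([] , _ , refl) , ())

singleVertex : (a b : Fin 1) → a ≡ b
singleVertex zero zero = refl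

mainTheorem6 : (T H : Graph) → Diam2 H → IsTree T → ¬ Isomorphic T K₂ →
    ¬ (∃ λ (D : PVertex T H → Set) → IsEOD T H D × IsParallel T H D)
mainTheorem6 T@(record { size = 1 }) H diam2 _ _ (D , eod , parallel)
  with ParallelEOD.tHasEdge T H D eod parallel diam2 zero
... | t , t' , t't = irrefl T (subst (Adj T t') (singleVertex t t') t't)
mainTheorem6 T@(record { size = 2 }) H _ (connected , _) notK₂ _ =
  notK₂ (connectedPairIsK₂ T refl connected)
mainTheorem6 T@(record { size = suc (suc (suc n)) }) H diam2 (connected , acyclic) _ (D , eod , parallel) =
  ParallelEOD.noLongPath T H D eod parallel diam2 acyclic 3 threeVertices ≤-refl
  where
  threeVertices : Paths.Path T 3
  threeVertices = Paths.threeVertexPath T connected zero (suc zero) (suc (suc zero)) (λ ()) (λ ()) (λ ())
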